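{- Let $\mathsf{HDT}$ be the full subcategory of $\mathsf{HDA}$ spanned by higher-dimensional trees and $\mathsf{HDT}_h$ the full subcategory of $\mathsf{HDA}_h$ spanned by higher-dimensional trees. The projection isomorphisms $\pi_X:\tilde X\to X$ ($X$ a higher-dimensional tree) extend to an isomorphism of categories $\mathsf{HDT}_h\cong\mathsf{HDT}$, namely the functor which is the identity on objects and sends a morphism $f:X\to Y$ of $\mathsf{HDT}_h$ (a pointed precubical morphism $f:\tilde X\to\tilde Y$) to $\pi_Y\circ f\circ\pi_X^{ -1}:X\to Y$.
   Context: A precubical set $X$ is a family of pairwise disjoint sets $(X_n)_{n\ge0}$ with face maps $\delta_k^\nu:X_n\to X_{n-1}$ ($n\ge1$, $1\le k\le n$, $\nu\in\{0,1\}$) satisfying $\delta_k^\nu\delta_\ell^\mu=\delta_{\ell-1}^\mu\delta_k^\nu$ for $k<\ell$; morphisms are families of maps commuting with face maps. An HDA is a precubical set with a distinguished $0$-cube $i$; $\mathsf{HDA}$ is the category of HDA and point-preserving morphisms. A cube path is a sequence $(x_1,\dots,x_m)$ with, for each $j<m$, $x_j=\delta_k^0x_{j+1}$ or $x_{j+1}=\delta_k^1x_j$ for some $k$; pointed if $x_1=i$. Two cube paths $(x_1,\dots,x_m)$, $(y_1,\dots,y_m)$ are adjacent if $x_1=y_1$, $x_m=y_m$, exactly one index $p$ has $x_p\ne y_p$, and for some $k<\ell$ one of the following holds, or holds with the paths interchanged: (i) $x_{p-1}=\delta_k^0x_p$, $x_p=\delta_\ell^0x_{p+1}$, $y_{p-1}=\delta_{\ell-1}^0y_p$,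 $y_p=\delta_k^0y_{p+1}$; (ii) $x_p=\delta_k^1x_{p-1}$, $x_{p+1}=\delta_\ell^1x_p$, $y_p=\delta_{\ell-1}^1y_{p-1}$, $y_{p+1}=\delta_k^1y_p$; (iii) $x_p=\delta_k^0\delta_\ell^1y_p$, $y_{p-1}=\delta_k^0y_p$, $y_{p+1}=\delta_\ell^1y_p$; (iv) $x_p=\delta_k^1\delta_\ell^0y_p$, $y_{p-1}=\delta_\ell^0y_p$, $y_{p+1}=\delta_k^1y_p$. Homotopy $\sim$ is the reflexive transitive closure of adjacency. An HDA is a higher-dimensional tree if for each cube $x$ there is exactly one homotopy class of pointed cube paths to $x$. The unfolding of $(X,i)$ is the HDA $\tilde X$ with $\tilde X_n$ = homotopy classes $[x_1,\dots,x_m]$ of pointed cube paths with $x_m\in X_n$, point $[i]$, $\tilde\delta_k^1[x_1,\dots,x_m]=[x_1,\dots,x_m,\delta_k^1x_m]$, $\tilde\delta_k^0[x_1,\dots,x_m]=\{(y_1,\dots,y_p)\mid y_p=\delta_k^0x_m,(y_1,\dots,y_p,x_m)\sim(x_1,\dots,x_m)\}$; $\pi_X[x_1,\dots,x_m]=x_m$ is a pointed morphism $\tilde X\to X$, which is an isomorphism when $X$ is a higher-dimensional tree. The category $\mathsf{HDA}_h$ has HDA as objects; a morphism $X\to Y$ is a pointed precubical morphism $\tilde X\to\tilde Y$ (composition as maps). -}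

module Defs where

open import Data.Nat using (ℕ; zero; suc; _<_; _∸_)
open import Data.Fin using (Fin; toℕ)
open import Data.Bool using (Bool; true; false)
open import Data.Product using (Σ; _×_; _,_; proj₁; proj₂; ∃)
open import Data.Sum using (_⊎_)
open import Data.Empty using (⊥)
open import Data.List using (List; []; _∷_; _++_; _∷ʳ_)
open import Data.List.Relation.Unary.Linked using (Linked; [-])
open import Relation.Binary.PropositionalEquality using (_≡_; refl)
open import Relation.Binary.Construct.Closure.ReflexiveTransitive using (Star)
open import Relation.Nullary using (¬_)

-- Face indices: the paper's 1-based index k (1 ≤ k ≤ n) on X_n is encoded by
-- a 0-based K : Fin n.  K ≐ k  says that K encodes the paper's index k.
_≐_ : ∀ {m} → Fin m → ℕ → Set
K ≐ k = suc (toℕ K) ≡ k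

-- ν ∈ {0,1} is encoded as Bool with false = 0, true = 1.

record PreCubical : Set₁ where
  field
    cube : ℕ → Set
    face : ∀ {n} → Fin (suc n) → Bool → cube (suc n) → cube n
    face-comm : ∀ {n} (ν μ : Bool) (k ℓ : ℕ) → k < ℓ →
      (K₁ : Fin (suc n)) (L₁ : Fin (suc (suc n)))
      (L₂ : Fin (suc n)) (K₂ : Fin (suc (suc n))) →
      K₁ ≐ k → L₁ ≐ ℓ → L₂ ≐ (ℓ ∸ 1) → K₂ ≐ k →
      (x : cube (suc (suc n))) →
      face K₁ ν (face L₁ μ x) ≡ face L₂ μ (face K₂ ν x)

record HDA : Set₁ where
  field
    pre   : PreCubical
    point : PreCubical.cube pre 0
  open PreCubical pre public

open HDA public

record IsHDAMor (X Y : HDA) (h : ∀ {n} → cube X n → cube Y n) : Set where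
  field
    pres-face  : ∀ {n} (K : Fin (suc n)) (ν : Bool) (x : cube X (suc n)) →
                 h (face X K ν x) ≡ face Y K ν (h x)
    pres-point : h (point X) ≡ point Y

module Paths (X : HDA) where

  -- cubes of all dimensions (the sets X_n are disjoint: a cube carries its dimension)
  Cell : Set
  Cell = Σ ℕ (cube X)

  data Step : Cell → Cell → Set where
    step0 : ∀ {n} (K : Fin (suc n)) (a : cube X n) (y : cube X (suc n)) →
            a ≡ face X K false y → Step (n , a) (suc n , y)
    step1 : ∀ {n} (K : Fin (suc n)) (x : cube X (suc n)) (b : cube X n) →
            b ≡ face X K true x → Step (suc n , x) (n , b)

  IsCubePath : List Cell → Set
  IsCubePath []       = ⊥
  IsCubePath (c ∷ cs) = Linked Step (c ∷ cs)

  IsPointedCubePath : List Cell → Set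
  IsPointedCubePath []       = ⊥
  IsPointedCubePath (c ∷ cs) = (c ≡ (0 , point X)) × IsCubePath (c ∷ cs)

  -- The local configurations (i)-(iv) of adjacency at position p:
  -- Adj3 x_{p-1} x_p y_p x_{p+1}  (recall x_{p-1} = y_{p-1}, x_{p+1} = y_{p+1}).
  data Adj3 : Cell → Cell → Cell → Cell → Set where
    adjI : ∀ {n} (k ℓ : ℕ) → k < ℓ →
      (K₁ : Fin (suc n)) (L₁ : Fin (suc (suc n)))
      (L₂ : Fin (suc n)) (K₂ : Fin (suc (suc n))) →
      K₁ ≐ k → L₁ ≐ ℓ → L₂ ≐ (ℓ ∸ 1) → K₂ ≐ k →
      (a : cube X n) (x y : cube X (suc n)) (b : cube X (suc (suc n))) →
      a ≡ face X K₁ false x → x ≡ face X L₁ false b →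
      a ≡ face X L₂ false y → y ≡ face X K₂ false b →
      Adj3 (n , a) (suc n , x) (suc n , y) (suc (suc n) , b)
    adjII : ∀ {n} (k ℓ : ℕ) → k < ℓ →
      (K₁ : Fin (suc (suc n))) (L₁ : Fin (suc n))
      (L₂ : Fin (suc (suc n))) (K₂ : Fin (suc n)) →
      K₁ ≐ k → L₁ ≐ ℓ → L₂ ≐ (ℓ ∸ 1) → K₂ ≐ k →
      (a : cube X (suc (suc n))) (x y : cube X (suc n)) (b : cube X n) →
      x ≡ face X K₁ true a → b ≡ face X L₁ true x →
      y ≡ face X L₂ true a → b ≡ face X K₂ true y →
      Adj3 (suc (suc n) , a) (suc n , x) (suc n , y) (n , b)
    adjIII : ∀ {n} (k ℓ : ℕ) → k < ℓ →
      (K₁ : Fin (suc n)) (L₁ : Fin (suc (suc n))) (K₂ : Fin (suc (suc n))) →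
      K₁ ≐ k → L₁ ≐ ℓ → K₂ ≐ k →
      (a : cube X (suc n)) (x : cube X n) (y : cube X (suc (suc n))) (b : cube X (suc n)) →
      x ≡ face X K₁ false (face X L₁ true y) →
      a ≡ face X K₂ false y → b ≡ face X L₁ true y →
      Adj3 (suc n , a) (n , x) (suc (suc n) , y) (suc n , b)
    adjIV : ∀ {n} (k ℓ : ℕ) → k < ℓ →
      (K₁ : Fin (suc n)) (L₁ : Fin (suc (suc n))) (K₂ : Fin (suc (suc n))) →
      K₁ ≐ k → L₁ ≐ ℓ → K₂ ≐ k →
      (a : cube X (suc n)) (x : cube X n) (y : cube X (suc (suc n))) (b : cube X (suc n)) →
      x ≡ face X K₁ true (face X L₁ false y) →
      a ≡ face X L₁ false y → b ≡ face X K₂ true y →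
      Adj3 (suc n , a) (n , x) (suc (suc n) , y) (suc n , b)

  Adjacent : List Cell → List Cell → Set
  Adjacent xs ys =
    Σ (List Cell) λ pre → Σ Cell λ a → Σ Cell λ x → Σ Cell λ y → Σ Cell λ b →
    Σ (List Cell) λ post →
      (xs ≡ pre ++ a ∷ x ∷ b ∷ post) × (ys ≡ pre ++ a ∷ y ∷ b ∷ post) ×
      ¬ (x ≡ y) × (Adj3 a x y b ⊎ Adj3 a y x b)

  _∼_ : List Cell → List Cell → Set
  _∼_ = Star Adjacent

  -- pointed cube paths (x_1,...,x_m) with x_m ∈ X_n, given as (x_1..x_{m-1}, x_m)
  PPath : ℕ → Set
  PPath n = Σ (List Cell) λ xs → Σ (cube X n) λ x → IsPointedCubePath (xs ∷ʳ (n , x))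

  seq : ∀ {n} → PPath n → List Cell
  seq {n} (xs , x , _) = xs ∷ʳ (n , x)

  end : ∀ {n} → PPath n → cube X n
  end (_ , x , _) = x

  _≈_ : ∀ {n} → PPath n → PPath n → Set
  p ≈ q = seq p ∼ seq q

  -- the trivial path (i), representing the point [i] of the unfolding
  basePath : PPath 0
  basePath = [] , point X , refl , [-]

  -- q ∈ δ̃_K^0 [p]  (the paper's description of the class δ̃_k^0[x_1..x_m])
  InFace0 : ∀ {n} → Fin (suc n) → PPath (suc n) → PPath n → Set
  InFace0 {n} K p q = (end q ≡ face X K false (end p)) × ((seq q ∷ʳ (suc n , end p)) ∼ seq p)

  IsTree : Set
  IsTree = ∀ n (x : cube X n) →
    (Σ (PPath n) λ p → end p ≡ x) ×
    (∀ (p q : PPath n) → end p ≡ x → end q ≡ x → p ≈ q)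

open Paths public

-- A morphism X → Y of HDA_h, i.e. a pointed precubical morphism X̃ → Ỹ,
-- given on representatives: f maps pointed paths to pointed paths, respects
-- homotopy (so is a map on classes), and commutes with the point and the faces
-- of the unfolding.
record IsHMor (X Y : HDA) (f : ∀ {n} → PPath X n → PPath Y n) : Set where
  field
    resp       : ∀ {n} (p q : PPath X n) → _≈_ X p q → _≈_ Y (f p) (f q)
    pres-point : _≈_ Y (f (basePath X)) (basePath Y)
    -- f (δ̃_k^1 [p]) = δ̃_k^1 (f [p]), where δ̃_k^1 [p] = [p , δ_k^1 (end p)]
    pres-face1 : ∀ {n} (K : Fin (suc n)) (p : PPath X (suc n)) (q : PPath X n) →
      seq X q ≡ seq X p ∷ʳ (n , face X K true (end X p)) →
      _∼_ Y (seq Y (f q)) (seq Y (f p) ∷ʳ (n , face Y K true (end Y (f p))))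
    pres-face0 : ∀ {n} (K : Fin (suc n)) (p : PPath X (suc n)) (q : PPath X n) →
      InFace0 X K p q → InFace0 Y K (f p) (f q)

πinv : (X : HDA) → IsTree X → ∀ {n} → cube X n → PPath X n
πinv X T {n} x = proj₁ (proj₁ (T n x))

Φ : (X Y : HDA) → IsTree X → (∀ {n} → PPath X n → PPath Y n) →
    ∀ {n} → cube X n → cube Y n
Φ X Y TX f x = end Y (f (πinv X TX x))

-- In a higher-dimensional tree every cube x has, up to homotopy, exactly one pointed
-- path π⁻¹ x to it, and two pointed paths are homotopic iff they end in the same cube
-- (homotopy never changes the last cube).  Hence a map f of unfoldings that respects
-- homotopy is determined by its effect on end cubes, Φ f (end p) = end (f p); the
-- structure maps of X̃ and Ỹ become those of X and Y under this identity, which gives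
-- functoriality, faithfulness and fullness at once.
module Submission where

open import Defs
open import Data.Nat using (suc)
open import Data.Nat.Properties using (≡-irrelevant)
open import Data.Product using (Σ; _×_; _,_; proj₁; proj₂)
open import Data.Product.Properties using (,-injectiveʳ-UIP)
open import Data.Maybe using (just)
open import Data.Maybe.Properties using (just-injective)
open import Data.Bool using (Bool; true; false)
open import Data.Fin using (Fin)
open import Data.List using (List; []; _∷_; _++_; _∷ʳ_; last)
open import Data.List.Properties using (∷ʳ-injectiveʳ)
open import Data.List.Relation.Unary.Linked using (Linked; [-]; _∷_)
open import Relation.Binary.Construct.Closure.ReflexiveTransitive using (ε; _◅_)
open import Relation.Binary.PropositionalEquality using (_≡_; refl; sym; trans; cong; module ≡-Reasoning)

last-++-∷ : ∀ {A : Set} (xs : List A) y ys → last (xs ++ y ∷ ys) ≡ last (y ∷ ys)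
last-++-∷ []           y ys = refl
last-++-∷ (x ∷ [])     y ys = refl
last-++-∷ (x ∷ x′ ∷ xs) y ys = last-++-∷ (x′ ∷ xs) y ys

last-∷ʳ : ∀ {A : Set} (xs : List A) x → last (xs ∷ʳ x) ≡ just x
last-∷ʳ xs x = last-++-∷ xs x []

module _ (X : HDA) where

  cell-injective : ∀ {n} {x y : cube X n} → _≡_ {A = Cell X} (n , x) (n , y) → x ≡ y
  cell-injective = ,-injectiveʳ-UIP ≡-irrelevant

  adjacent-last : ∀ {xs ys} → Adjacent X xs ys → last xs ≡ last ys
  adjacent-last (pre , a , x , y , b , post , refl , refl , _) =
    trans (last-++-∷ pre a (x ∷ b ∷ post)) (sym (last-++-∷ pre a (y ∷ b ∷ post)))

  ∼-last : ∀ {xs ys} → _∼_ X xs ys → last xs ≡ last ys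
  ∼-last ε        = refl
  ∼-last (a ◅ as) = trans (adjacent-last a) (∼-last as)

  ∼-∷ʳ⇒end≡ : ∀ {n} (p : PPath X n) (ys : List (Cell X)) (y : cube X n) →
              _∼_ X (seq X p) (ys ∷ʳ (n , y)) → end X p ≡ y
  ∼-∷ʳ⇒end≡ (xs , x , _) ys y s =
    cell-injective (just-injective (trans (sym (last-∷ʳ xs _)) (trans (∼-last s) (last-∷ʳ ys _))))

  ≈⇒end≡ : ∀ {n} (p q : PPath X n) → _≈_ X p q → end X p ≡ end X q
  ≈⇒end≡ p (ys , y , _) = ∼-∷ʳ⇒end≡ p ys y

  seq-∷ʳ⇒end≡ : ∀ {n} (p : PPath X n) (ys : List (Cell X)) (y : cube X n) →
                seq X p ≡ ys ∷ʳ (n , y) → end X p ≡ y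
  seq-∷ʳ⇒end≡ (xs , _ , _) ys y eq = cell-injective (∷ʳ-injectiveʳ xs ys eq)

  linked-∷ʳ : ∀ {a b c} xs → Linked (Step X) (a ∷ (xs ∷ʳ b)) → Step X b c →
              Linked (Step X) (a ∷ ((xs ∷ʳ b) ∷ʳ c))
  linked-∷ʳ []       (s ∷ [-]) t = s ∷ t ∷ [-]
  linked-∷ʳ (_ ∷ xs) (s ∷ ss)  t = s ∷ linked-∷ʳ xs ss t

  pointed-∷ʳ : ∀ {b c} xs → IsPointedCubePath X (xs ∷ʳ b) → Step X b c →
               IsPointedCubePath X ((xs ∷ʳ b) ∷ʳ c)
  pointed-∷ʳ []       (e , [-]) t = e , t ∷ [-]
  pointed-∷ʳ (_ ∷ xs) (e , ss)  t = e , linked-∷ʳ xs ss t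

  extend : ∀ {n m} (p : PPath X n) {c : cube X m} → Step X (n , end X p) (m , c) → PPath X m
  extend (xs , x , ip) {c} t = xs ∷ʳ (_ , x) , c , pointed-∷ʳ xs ip t

module _ {X : HDA} (T : IsTree X) where

  end-πinv : ∀ {n} (x : cube X n) → end X (πinv X T x) ≡ x
  end-πinv {n} x = proj₂ (proj₁ (T n x))

  end≡⇒≈ : ∀ {n} (p q : PPath X n) → end X p ≡ end X q → _≈_ X p q
  end≡⇒≈ p q e = proj₂ (T _ (end X q)) p q e refl

  πinv-end≈ : ∀ {n} (p : PPath X n) → _≈_ X (πinv X T (end X p)) p
  πinv-end≈ p = end≡⇒≈ (πinv X T (end X p)) p (end-πinv (end X p))

module _ {X Y : HDA} (TX : IsTree X) {f : ∀ {n} → PPath X n → PPath Y n} (H : IsHMor X Y f) where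
  open IsHMor H
  open ≡-Reasoning

  Φ-end : ∀ {n} (p : PPath X n) → Φ X Y TX f (end X p) ≡ end Y (f p)
  Φ-end p = ≈⇒end≡ Y (f (πinv X TX (end X p))) (f p) (resp _ p (πinv-end≈ TX p))

  Φ-face1 : ∀ {n} (K : Fin (suc n)) (x : cube X (suc n)) →
            Φ X Y TX f (face X K true x) ≡ face Y K true (Φ X Y TX f x)
  Φ-face1 K x = begin
    Φ X Y TX f (face X K true x)        ≡⟨ cong (λ y → Φ X Y TX f (face X K true y)) (sym (end-πinv TX x)) ⟩
    Φ X Y TX f (end X q)                ≡⟨ Φ-end q ⟩
    end Y (f q)                         ≡⟨ ∼-∷ʳ⇒end≡ Y (f q) _ _ (pres-face1 K p q refl) ⟩
    face Y K true (Φ X Y TX f x)        ∎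
    where
    p = πinv X TX x
    q = extend X p (step1 K (end X p) _ refl)

  Φ-face0 : ∀ {n} (K : Fin (suc n)) (x : cube X (suc n)) →
            Φ X Y TX f (face X K false x) ≡ face Y K false (Φ X Y TX f x)
  Φ-face0 K x = proj₁ (pres-face0 K p q (end-q , end≡⇒≈ TX (extend X q (step0 K _ _ end-q)) p refl))
    where
    p = πinv X TX x
    q = πinv X TX (face X K false x)
    end-q : end X q ≡ face X K false (end X p)
    end-q = trans (end-πinv TX _) (cong (face X K false) (sym (end-πinv TX x)))

  Φ-isHDAMor : IsHDAMor X Y (Φ X Y TX f)
  Φ-isHDAMor = record
    { pres-face  = λ { K true x → Φ-face1 K x ; K false x → Φ-face0 K x }
    ; pres-point = trans (Φ-end (basePath X)) (≈⇒end≡ Y (f (basePath X)) (basePath Y) pres-point)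
    }

Φ-∘ : {X Y Z : HDA} (TX : IsTree X) (TY : IsTree Y)
      (f : ∀ {n} → PPath X n → PPath Y n) {g : ∀ {n} → PPath Y n → PPath Z n} → IsHMor Y Z g →
      ∀ {n} (x : cube X n) → Φ X Z TX (λ p → g (f p)) x ≡ Φ Y Z TY g (Φ X Y TX f x)
Φ-∘ {X} TX TY f Hg x = sym (Φ-end TY Hg (f (πinv X TX x)))

Φ-injective : {X Y : HDA} (TX : IsTree X) (TY : IsTree Y) {f g : ∀ {n} → PPath X n → PPath Y n} →
              IsHMor X Y f → IsHMor X Y g → (∀ {n} (x : cube X n) → Φ X Y TX f x ≡ Φ X Y TX g x) →
              ∀ {n} (p : PPath X n) → _≈_ Y (f p) (g p)
Φ-injective {X} {Y} TX TY {f} {g} Hf Hg Φf≡Φg p = end≡⇒≈ TY (f p) (g p) (begin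
  end Y (f p)                 ≡⟨ sym (Φ-end TX Hf p) ⟩
  Φ X Y TX f (end X p)        ≡⟨ Φf≡Φg (end X p) ⟩
  Φ X Y TX g (end X p)        ≡⟨ Φ-end TX Hg p ⟩
  end Y (g p)                 ∎)
  where open ≡-Reasoning

module _ {X Y : HDA} (TY : IsTree Y) {h : ∀ {n} → cube X n → cube Y n} (Hh : IsHDAMor X Y h)
         {f : ∀ {n} → PPath X n → PPath Y n} (f-end : ∀ {n} (p : PPath X n) → end Y (f p) ≡ h (end X p)) where
  open IsHDAMor Hh
  open ≡-Reasoning

  end-face : ∀ {n} (K : Fin (suc n)) (ν : Bool) (p : PPath X (suc n)) (q : PPath X n) →
             end X q ≡ face X K ν (end X p) → end Y (f q) ≡ face Y K ν (end Y (f p))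
  end-face K ν p q e = begin
    end Y (f q)                 ≡⟨ f-end q ⟩
    h (end X q)                 ≡⟨ cong h e ⟩
    h (face X K ν (end X p))    ≡⟨ pres-face K ν (end X p) ⟩
    face Y K ν (h (end X p))    ≡⟨ cong (face Y K ν) (sym (f-end p)) ⟩
    face Y K ν (end Y (f p))    ∎

  end-natural⇒isHMor : IsHMor X Y f
  end-natural⇒isHMor = record
    { resp       = λ p q p≈q → end≡⇒≈ TY (f p) (f q)
                     (trans (f-end p) (trans (cong h (≈⇒end≡ X p q p≈q)) (sym (f-end q))))
    ; pres-point = end≡⇒≈ TY (f (basePath X)) (basePath Y) (trans (f-end (basePath X)) pres-point)
    ; pres-face1 = λ K p q q≡p▷ → end≡⇒≈ TY (f q) (extend Y (f p) (step1 K _ _ refl))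
                     (end-face K true p q (seq-∷ʳ⇒end≡ X q (seq X p) _ q≡p▷))
    ; pres-face0 = λ K p q (end-q , _) → let end-fq = end-face K false p q end-q in
                     end-fq , end≡⇒≈ TY (extend Y (f q) (step0 K _ _ end-fq)) (f p) refl
    }

lift : {X Y : HDA} → IsTree Y → (∀ {n} → cube X n → cube Y n) → ∀ {n} → PPath X n → PPath Y n
lift {X} {Y} TY h p = πinv Y TY (h (end X p))

Φ-lift : {X Y : HDA} (TX : IsTree X) (TY : IsTree Y) (h : ∀ {n} → cube X n → cube Y n) →
         ∀ {n} (x : cube X n) → Φ X Y TX (lift TY h) x ≡ h x
Φ-lift TX TY h x = trans (end-πinv TY _) (cong h (end-πinv TX x))

lemma5p2 :
    ((X Y : HDA) (TX : IsTree X) (TY : IsTree Y) (f : ∀ {n} → PPath X n → PPath Y n) →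
       IsHMor X Y f → IsHDAMor X Y (Φ X Y TX f))
    × ((X Y : HDA) (TX : IsTree X) (TY : IsTree Y) (f g : ∀ {n} → PPath X n → PPath Y n) →
       IsHMor X Y f → IsHMor X Y g → (∀ n (p : PPath X n) → _≈_ Y (f p) (g p)) →
       ∀ n (x : cube X n) → Φ X Y TX f x ≡ Φ X Y TX g x)
    × ((X : HDA) (TX : IsTree X) → ∀ n (x : cube X n) → Φ X X TX (λ p → p) x ≡ x)
    × ((X Y Z : HDA) (TX : IsTree X) (TY : IsTree Y) (TZ : IsTree Z)
       (f : ∀ {n} → PPath X n → PPath Y n) (g : ∀ {n} → PPath Y n → PPath Z n) →
       IsHMor X Y f → IsHMor Y Z g →
       ∀ n (x : cube X n) → Φ X Z TX (λ p → g (f p)) x ≡ Φ Y Z TY g (Φ X Y TX f x))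
    × ((X Y : HDA) (TX : IsTree X) (TY : IsTree Y) (f g : ∀ {n} → PPath X n → PPath Y n) →
       IsHMor X Y f → IsHMor X Y g → (∀ n (x : cube X n) → Φ X Y TX f x ≡ Φ X Y TX g x) →
       ∀ n (p : PPath X n) → _≈_ Y (f p) (g p))
    × ((X Y : HDA) (TX : IsTree X) (TY : IsTree Y) (h : ∀ {n} → cube X n → cube Y n) →
       IsHDAMor X Y h →
       Σ (∀ {n} → PPath X n → PPath Y n) λ f →
         IsHMor X Y f × (∀ n (x : cube X n) → Φ X Y TX f x ≡ h x))
lemma5p2 =
    (λ X Y TX TY f Hf → Φ-isHDAMor TX Hf)
  , (λ X Y TX TY f g Hf Hg f≈g n x → ≈⇒end≡ Y (f (πinv X TX x)) (g (πinv X TX x)) (f≈g n (πinv X TX x)))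
  , (λ X TX n x → end-πinv TX x)
  , (λ X Y Z TX TY TZ f g Hf Hg n x → Φ-∘ TX TY f Hg x)
  , (λ X Y TX TY f g Hf Hg Φf≡Φg n p → Φ-injective TX TY Hf Hg (Φf≡Φg _) p)
  , (λ X Y TX TY h Hh → lift TY h
       , end-natural⇒isHMor TY Hh (λ p → end-πinv TY (h (end X p)))
       , λ n x → Φ-lift TX TY h x)
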